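{- Let $A$ be a graph such that $A\otimes A$ is $2$-connected. Then $A$ is $2$-connected.
   Context: All graphs are finite and simple. A graph is $2$-connected if it has more than $2$ vertices and removing any single vertex leaves it connected. $A\otimes A$ denotes the Sierpiński product $A\otimes_f A$ with $f$ the identity on $V(A)$, i.e. the graph with vertex set $V(A)\times V(A)$ and edge set $\{(a,b_1)(a,b_2): b_1b_2\in E(A)\}\cup\{(a_1,a_2)(a_2,a_1) : a_1a_2\in E(A)\}$. -}

module Defs where

open import Level using (Level; _⊔_; suc)
open import Data.Nat using (ℕ; _*_)
open import Data.Fin.Properties using (*↔×)
open import Function.Properties.Inverse using (↔-trans; ↔-sym)
open import Data.Product.Function.NonDependent.Propositional using (_×-↔_)
open import Data.Fin using (Fin)
open import Data.Product using (_×_; _,_; Σ; ∃-syntax)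
open import Data.Empty using (⊥)
open import Relation.Nullary using (¬_)
open import Relation.Binary.PropositionalEquality using (_≡_)
open import Function.Bundles using (_↔_)

record Graph : Set₁ where
  field
    V      : Set
    size   : ℕ
    finite : V ↔ Fin size
    Adj    : V → V → Set
    sym    : ∀ {x y} → Adj x y → Adj y x
    irrefl : ∀ {x} → ¬ Adj x x

module _ (G : Graph) where
  open Graph G

  data WalkIn (P : V → Set) : V → V → Set where
    here : ∀ {x} → P x → WalkIn P x x
    step : ∀ {x y z} → P x → Adj x y → WalkIn P y z → WalkIn P x z

  ConnectedOn : (V → Set) → Set
  ConnectedOn P = ∀ x y → P x → P y → WalkIn P x y

  ConnectedMinus : V → Set
  ConnectedMinus v = ConnectedOn (λ x → ¬ x ≡ v)

  MoreThanTwo : Set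
  MoreThanTwo = Σ V λ a → Σ V λ b → Σ V λ c →
                  (¬ a ≡ b) × (¬ a ≡ c) × (¬ b ≡ c)

  TwoConnected : Set
  TwoConnected = MoreThanTwo × (∀ v → ConnectedMinus v)

-- ⊗-self A is the Sierpinski product A ⊗ A (with f the identity on V(A)):
-- vertices V(A) × V(A); edges (a,b₁)(a,b₂) for b₁b₂ ∈ E(A), and
-- (a₁,a₂)(a₂,a₁) for a₁a₂ ∈ E(A).
data ⊗Adj (A : Graph) : (Graph.V A × Graph.V A) → (Graph.V A × Graph.V A) → Set where
  inner  : ∀ {a b₁ b₂} → Graph.Adj A b₁ b₂ → ⊗Adj A (a , b₁) (a , b₂)
  bridge : ∀ {a₁ a₂} → Graph.Adj A a₁ a₂ → ⊗Adj A (a₁ , a₂) (a₂ , a₁)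

⊗Adj-sym : ∀ A {x y} → ⊗Adj A x y → ⊗Adj A y x
⊗Adj-sym A (inner e)  = inner (Graph.sym A e)
⊗Adj-sym A (bridge e) = bridge (Graph.sym A e)

⊗Adj-irrefl : ∀ A {x} → ¬ ⊗Adj A x x
⊗Adj-irrefl A (inner e)  = Graph.irrefl A e
⊗Adj-irrefl A (bridge e) = Graph.irrefl A e

⊗-self : Graph → Graph
⊗-self A = record
  { V      = Graph.V A × Graph.V A
  ; size   = Graph.size A * Graph.size A
  ; finite = ↔-trans (Graph.finite A ×-↔ Graph.finite A) (↔-sym *↔×)
  ; Adj    = ⊗Adj A
  ; sym    = ⊗Adj-sym A
  ; irrefl = ⊗Adj-irrefl A
  }

{-# OPTIONS --safe #-}
-- Collapse every copy {a} × A of A ⊗ A to the vertex a, except the copy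
-- {v} × A, which is mapped identically onto A. Edges go to edges or are contracted,
-- (v , v) is the only vertex sent to v, and (x , x) is sent to x, so walks
-- of A ⊗ A avoiding (v , v) become walks of A avoiding v. For the third
-- vertex: given distinct a, b, a walk from (a , a) to (b , b) avoiding
-- (a , b) must leave (a , a) along an edge to some (a , c), and c ∉ {a , b}.
module Submission where

open import Defs
open import Data.Fin.Properties using (inj⇒≟)
open import Data.Product using (_×_; _,_; Σ)
open import Data.Sum using (_⊎_; inj₁; inj₂)
open import Data.Empty using (⊥-elim)
open import Function.Properties.Inverse using (↔⇒↣)
open import Relation.Nullary using (¬_; yes; no)
open import Relation.Binary.Definitions using (DecidableEquality)
open import Relation.Binary.PropositionalEquality using (_≡_; refl; sym; subst; subst₂)

module _ (G : Graph) where
  open Graph G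

  walkIn-head : ∀ {P x y} → WalkIn G P x y → P x
  walkIn-head (here px)     = px
  walkIn-head (step px _ _) = px

  walkIn-leaves : ∀ {P x y} → WalkIn G P x y → ¬ x ≡ y → Σ V λ z → Adj x z × P z
  walkIn-leaves (here _)     x≢x = ⊥-elim (x≢x refl)
  walkIn-leaves (step _ e w) _   = _ , e , walkIn-head w

module _ {G H : Graph} where
  private
    module G = Graph G
    module H = Graph H

  walkIn-map : ∀ {P Q} (f : G.V → H.V) → (∀ {x} → P x → Q (f x)) →
               (∀ {x y} → G.Adj x y → f x ≡ f y ⊎ H.Adj (f x) (f y)) →
               ∀ {x y} → WalkIn G P x y → WalkIn H Q (f x) (f y)
  walkIn-map f pres adj (here px) = here (pres px)
  walkIn-map {Q = Q} f pres adj {y = z} (step px e w) with adj e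
  ... | inj₁ fx≡fy = subst (λ u → WalkIn H Q u (f z)) (sym fx≡fy) (walkIn-map f pres adj w)
  ... | inj₂ fe     = step (pres px) fe (walkIn-map f pres adj w)

module _ (A : Graph) where
  open Graph A

  _≟_ : DecidableEquality V
  _≟_ = inj⇒≟ (↔⇒↣ finite)

  ×-distinct : {p q : V × V} → ¬ p ≡ q → Σ V λ a → Σ V λ b → ¬ a ≡ b
  ×-distinct {a , a′} {b , b′} p≢q with a ≟ b
  ... | no a≢b   = a , b , a≢b
  ... | yes refl = a′ , b′ , λ { refl → p≢q refl }

  collapse : V → V × V → V
  collapse v (a , b) with a ≟ v
  ... | yes _ = b
  ... | no  _ = a

  collapse-diagonal : ∀ v x → collapse v (x , x) ≡ x
  collapse-diagonal v x with x ≟ v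
  ... | yes _ = refl
  ... | no  _ = refl

  collapse-avoids : ∀ {v p} → ¬ p ≡ (v , v) → ¬ collapse v p ≡ v
  collapse-avoids {v} {a , b} p≢vv with a ≟ v
  ... | yes refl = λ { refl → p≢vv refl }
  ... | no  a≢v  = a≢v

  collapse-adj : ∀ {v p q} → ⊗Adj A p q →
                 collapse v p ≡ collapse v q ⊎ Adj (collapse v p) (collapse v q)
  collapse-adj {v} (inner {a} e) with a ≟ v
  ... | yes _ = inj₂ e
  ... | no  _ = inj₁ refl
  collapse-adj {v} (bridge {a₁} {a₂} e) with a₁ ≟ v | a₂ ≟ v
  ... | yes refl | yes refl = ⊥-elim (irrefl e)
  ... | yes _    | no  _    = inj₁ refl
  ... | no  _    | yes _    = inj₁ refl
  ... | no  _    | no  _    = inj₂ e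

  connectedMinus-⊗ : ∀ v → ConnectedMinus (⊗-self A) (v , v) → ConnectedMinus A v
  connectedMinus-⊗ v conn x y x≢v y≢v =
    subst₂ (WalkIn A _) (collapse-diagonal v x) (collapse-diagonal v y)
      (walkIn-map (collapse v) collapse-avoids collapse-adj
        (conn (x , x) (y , y) (λ { refl → x≢v refl }) (λ { refl → y≢v refl })))

  third-vertex : ∀ {a b} → ¬ a ≡ b → ConnectedMinus (⊗-self A) (a , b) →
                 Σ V λ c → ¬ a ≡ c × ¬ b ≡ c
  third-vertex {a} {b} a≢b conn
    with walkIn-leaves (⊗-self A)
           (conn (a , a) (b , b) (λ { refl → a≢b refl }) (λ { refl → a≢b refl }))
           (λ { refl → a≢b refl })
  ... | (_ , c) , inner a~c , ac≢ab = c , (λ { refl → irrefl a~c }) , λ { refl → ac≢ab refl }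
  ... | _ , bridge a~a , _          = ⊥-elim (irrefl a~a)

lemma3p2 : (A : Graph) → TwoConnected (⊗-self A) → TwoConnected A
lemma3p2 A ((p , q , _ , p≢q , _) , conn) with ×-distinct A p≢q
... | a , b , a≢b with third-vertex A a≢b (conn (a , b))
... | c , a≢c , b≢c = (a , b , c , a≢b , a≢c , b≢c) , λ v → connectedMinus-⊗ A v (conn (v , v))
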